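{- Let $u$ be a vertex of a graph $G=(V,E)$ and let $H=(V,E\cup F)$ be a minimal triangulation of $G$ such that $u$ is not incident to any edge of $F$. Then $u$ is avoidable in $G$ if and only if $u$ is simplicial in $H$.
   Context: All graphs are finite, simple and undirected. A vertex $v$ of a graph $G$ is avoidable if every induced path on three vertices with middle vertex $v$ is contained in an induced cycle of $G$. A vertex is simplicial if its neighborhood is a clique. A graph is chordal if it has no induced cycle of length more than three. A graph $H=(V,E\cup F)$ (with $F\cap E=\emptyset$) is a minimal triangulation of $G=(V,E)$ if $H$ is chordal and for every proper subset $F'\subsetneq F$ the graph $(V,E\cup F')$ is not chordal; the edges of $F$ are fill edges. -}

module Defs where

open import Data.Nat using (ℕ; suc; _≤_; _∸_)
open import Data.Fin using (Fin; toℕ)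
open import Data.Bool using (Bool; true; false)
open import Data.Product using (Σ; _×_; ∃; ∃-syntax; _,_)
open import Data.Sum using (_⊎_)
open import Relation.Binary.PropositionalEquality using (_≡_; _≢_)
open import Relation.Nullary using (¬_)
open import Function.Definitions using (Injective)

record Graph (n : ℕ) : Set where
  field
    adj   : Fin n → Fin n → Bool
    sym   : ∀ x y → adj x y ≡ adj y x
    irrefl : ∀ x → adj x x ≡ false
open Graph public

Adj : ∀ {n} → Graph n → Fin n → Fin n → Set
Adj G x y = adj G x y ≡ true

_⊆E_ : ∀ {n} → Graph n → Graph n → Set
G ⊆E H = ∀ x y → Adj G x y → Adj H x y

Next : (k : ℕ) → Fin k → Fin k → Set
Next k i j = (toℕ j ≡ suc (toℕ i)) ⊎ ((toℕ i ≡ k ∸ 1) × (toℕ j ≡ 0))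

CycAdj : (k : ℕ) → Fin k → Fin k → Set
CycAdj k i j = Next k i j ⊎ Next k j i

record InducedCycle {n : ℕ} (G : Graph n) (k : ℕ) : Set where
  field
    len≥3   : 3 ≤ k
    vtx     : Fin k → Fin n
    vtx-inj : Injective _≡_ _≡_ vtx
    edges   : ∀ i j → Adj G (vtx i) (vtx j) → CycAdj k i j
    cycle   : ∀ i j → CycAdj k i j → Adj G (vtx i) (vtx j)
open InducedCycle public

OnCycle : ∀ {n k} {G : Graph n} → InducedCycle G k → Fin n → Set
OnCycle {k = k} C v = ∃[ i ] vtx C i ≡ v

-- Since the cycle is induced, containing the three
-- vertices means containing the path as a subgraph.
PathInInducedCycle : ∀ {n} → Graph n → Fin n → Fin n → Fin n → Set
PathInInducedCycle G x v y =
  ∃[ k ] Σ (InducedCycle G k) λ C → OnCycle C x × OnCycle C v × OnCycle C y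

Avoidable : ∀ {n} → Graph n → Fin n → Set
Avoidable G v = ∀ x y → Adj G x v → Adj G v y → x ≢ y → ¬ Adj G x y →
  PathInInducedCycle G x v y

Simplicial : ∀ {n} → Graph n → Fin n → Set
Simplicial G v = ∀ x y → Adj G v x → Adj G v y → x ≢ y → Adj G x y

Chordal : ∀ {n} → Graph n → Set
Chordal G = ∀ k → 4 ≤ k → ¬ InducedCycle G k

-- H = (V, E ∪ F) is a minimal triangulation of G = (V, E):
-- H contains G, H is chordal, and for every proper subset F' ⊊ F
-- (i.e. every graph H' with G ⊆ H' ⊆ H missing some edge of H) H' is not chordal.
MinimalTriangulation : ∀ {n} → Graph n → Graph n → Set
MinimalTriangulation {n} G H =
  G ⊆E H × Chordal H ×
  (∀ (H' : Graph n) → G ⊆E H' → H' ⊆E H →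
     (∃[ x ] ∃[ y ] (Adj H x y × ¬ Adj H' x y)) → ¬ Chordal H')

NoFillAt : ∀ {n} → Graph n → Graph n → Fin n → Set
NoFillAt G H u = ∀ w → Adj H u w → Adj G u w

-- Chordality is used through a local characterization: K is chordal iff for every vertex c,
-- two distinct neighbours of c joined by a walk whose inner vertices avoid N[c] are adjacent.
-- (Shortening such a walk to an induced path closes an induced cycle of length ≥ 4 through c;
-- conversely, an induced cycle of length ≥ 4 is such a walk around any of its vertices.)
--
-- If u is avoidable and x, y are non-adjacent neighbours of u, the induced cycle of G through
-- x - u - y contains a walk from x to y avoiding N_G[u]; as no fill edge meets u, it also avoids
-- N_H[u], so xy is an edge of the chordal graph H.
--
-- Conversely, let x - u - y be an induced path of G and A the set of vertices reachable from x in
-- G without entering N[u]. If y has a neighbour in A, a path through A closes an induced cycle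
-- through x, u, y. Otherwise delete from H every edge between A and the vertices that are neither
-- in A nor on its boundary (its G-neighbours outside A). The boundary lies in N[u], a clique of H
-- as u is simplicial, so walks crossing it can be shortcut and the smaller graph is still chordal.
-- It contains G but not xy, which is an edge of H: this contradicts the minimality of H.

module Submission where

open import Defs hiding (sym)
open import Data.Bool using (true; not; _∧_)
import Data.Bool.Properties as Bool
open import Data.Empty using (⊥-elim)
open import Data.Fin using (Fin; toℕ; fromℕ; fromℕ<; inject₁; lower₁) renaming (zero to fz; suc to fs)
import Data.Fin.Properties as Fin
open import Data.Fin.Subset using (Subset; _∈_; _∉_; _⊂_; ⁅_⁆; ∣_∣)
open import Data.Fin.Subset.Properties
  using (_∈?_; _⊂?_; p⊂q⇒∣p∣<∣q∣; ∣p∣≤n; x∈⁅x⁆; x∈⁅y⁆⇒x≡y; ∣⁅x⁆∣≡1)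
open import Data.List using (List; []; _∷_; length; lookup)
open import Data.List.Membership.Propositional.Properties using (∈-lookup)
open import Data.List.Relation.Unary.All as All using (All; []; _∷_)
open import Data.List.Relation.Unary.All.Properties using (¬Any⇒All¬)
open import Data.List.Relation.Unary.Any using (Any; here; there; any?)
open import Data.Nat using (ℕ; zero; suc; _+_; _≤_; _<_; z≤n; s≤s; s≤s⁻¹)
import Data.Nat.Properties as ℕ
open import Data.Product using (Σ; _×_; ∃; ∃₂; _,_; proj₁; proj₂)
open import Data.Sum as Sum using (_⊎_; inj₁; inj₂)
open import Data.Unit using (⊤; tt)
import Data.Vec as Vec
import Data.Vec.Properties as Vec
open import Function.Base using (id; case_of_)
open import Function.Bundles using (Equivalence; mk⇔)
open import Relation.Binary.PropositionalEquality
open import Relation.Nullary using (¬_; Dec; yes; no)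
open import Relation.Nullary.Decidable using (_⊎-dec_; _×-dec_; ¬?; does; does-⇔; isYes; toWitness; fromWitness)

module AdjProperties {n : ℕ} (K : Graph n) where

  adj? : (x y : Fin n) → Dec (Adj K x y)
  adj? x y = adj K x y Bool.≟ true

  adj-sym : ∀ {x y} → Adj K x y → Adj K y x
  adj-sym {x} {y} e = trans (Graph.sym K y x) e

  adj⇒≢ : ∀ {x y} → Adj K x y → x ≢ y
  adj⇒≢ {x} e refl with trans (sym e) (Graph.irrefl K x)
  ... | ()

data Walk {n : ℕ} (K : Graph n) (Q : Fin n → Set) : Fin n → Fin n → Set where
  stop : ∀ {a} → Walk K Q a a
  step : ∀ {a w b} → Adj K a w → Q w → Walk K Q w b → Walk K Q a b

module _ {n : ℕ} {K : Graph n} {Q : Fin n → Set} where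

  mapWalk : ∀ {K′ : Graph n} {Q′ : Fin n → Set} {a b} →
            (∀ {p q} → Adj K p q → Adj K′ p q) → (∀ {w} → Q w → Q′ w) →
            Walk K Q a b → Walk K′ Q′ a b
  mapWalk f g stop         = stop
  mapWalk f g (step e q w) = step (f e) (g q) (mapWalk f g w)

  snocWalk : ∀ {a b c} → Walk K Q a b → Adj K b c → Q c → Walk K Q a c
  snocWalk stop          e q = step e q stop
  snocWalk (step e′ q′ w) e q = step e′ q′ (snocWalk w e q)

Outside : ∀ {n} → Graph n → Fin n → Fin n → Set
Outside K c w = w ≢ c × ¬ Adj K c w

Detour : ∀ {n} → Graph n → Fin n → Fin n → Fin n → Set
Detour K c a b = Walk K (λ w → Outside K c w ⊎ w ≡ b) a b

ShortcutProperty : ∀ {n} → Graph n → Set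
ShortcutProperty K = ∀ c a b → Adj K c a → Adj K c b → a ≢ b → Detour K c a b → Adj K a b

CycAdj-sym : ∀ {k} {i j : Fin k} → CycAdj k i j → CycAdj k j i
CycAdj-sym (inj₁ ij) = inj₂ ij
CycAdj-sym (inj₂ ji) = inj₁ ji

module InducedPaths {n : ℕ} (K : Graph n) where

  open AdjProperties K

  IsInducedPath : List (Fin n) → Set
  IsInducedPath []          = ⊤
  IsInducedPath (p ∷ [])    = ⊤
  IsInducedPath (p ∷ q ∷ r) = Adj K p q × All (Outside K p) r × IsInducedPath (q ∷ r)

  data EndsAt (b : Fin n) : List (Fin n) → Set where
    end  : EndsAt b (b ∷ [])
    more : ∀ {x xs} → EndsAt b xs → EndsAt b (x ∷ xs)

  IsInducedPath-tail : ∀ {m M} → IsInducedPath (m ∷ M) → IsInducedPath M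
  IsInducedPath-tail {M = []}    _             = tt
  IsInducedPath-tail {M = _ ∷ _} (_ , _ , path) = path

  Related : Fin n → Fin n → Set
  Related a v = Adj K a v ⊎ a ≡ v

  unrelated⇒outside : ∀ {a v} → ¬ Related a v → Outside K a v
  unrelated⇒outside ¬r = (λ v≡a → ¬r (inj₂ (sym v≡a))) , (λ e → ¬r (inj₁ e))

  module _ {Q : Fin n → Set} {b : Fin n} where

    dropToLastRelated : ∀ a M → IsInducedPath M → EndsAt b M → All Q M → Any (Related a) M →
      ∃₂ λ v M′ → IsInducedPath (v ∷ M′) × EndsAt b (v ∷ M′) × All Q (v ∷ M′) ×
                  Related a v × All (Outside K a) M′
    dropToLastRelated a (m ∷ M) path end′ (qm ∷ qM) rel with any? (λ v → adj? a v ⊎-dec (a Fin.≟ v)) M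
    dropToLastRelated a (m ∷ M) path (more end′) (qm ∷ qM) rel | yes relM =
      dropToLastRelated a M (IsInducedPath-tail path) end′ qM relM
    dropToLastRelated a (m ∷ [])    path end (qm ∷ qM) rel | yes ()
    dropToLastRelated a (m ∷ M) path end′ qM (here r)      | no ¬relM =
      m , M , path , end′ , qM , r , All.map unrelated⇒outside (¬Any⇒All¬ M ¬relM)
    dropToLastRelated a (m ∷ M) path end′ qM (there relM)  | no ¬relM = ⊥-elim (¬relM relM)

  toInducedPath : ∀ {Q a b} → Walk K Q a b →
                  ∃ λ L → IsInducedPath (a ∷ L) × EndsAt b (a ∷ L) × All Q L
  toInducedPath stop = [] , tt , end , []
  toInducedPath {a = a} (step {w = w} e qw rest) with toInducedPath rest
  ... | L , path , end′ , qL with dropToLastRelated a (w ∷ L) path end′ (qw ∷ qL) (here (inj₁ e))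
  ...   | v , M , pathM , endM , _ ∷ qM , inj₂ refl , _     = M , pathM , endM , qM
  ...   | v , M , pathM , endM , qvM    , inj₁ av  , apart = v ∷ M , (av , apart , pathM) , more endM , qvM

  All-lookup : ∀ {P : Fin n → Set} {L} → All P L → ∀ i → P (lookup L i)
  All-lookup ps i = All.lookup ps (∈-lookup i)

  lookup-injective : ∀ {L} → IsInducedPath L → ∀ i j → lookup L i ≡ lookup L j → i ≡ j
  lookup-injective {_ ∷ []}    _               fz          fz          _  = refl
  lookup-injective {_ ∷ _ ∷ _} _               fz          fz          _  = refl
  lookup-injective {_ ∷ _ ∷ _} (pq , _ , _)    fz          (fs fz)     eq = ⊥-elim (adj⇒≢ pq eq)
  lookup-injective {_ ∷ _ ∷ _} (_ , far , _)   fz          (fs (fs j)) eq = ⊥-elim (proj₁ (All-lookup far j) (sym eq))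
  lookup-injective {_ ∷ _ ∷ _} (pq , _ , _)    (fs fz)     fz          eq = ⊥-elim (adj⇒≢ pq (sym eq))
  lookup-injective {_ ∷ _ ∷ _} (_ , far , _)   (fs (fs i)) fz          eq = ⊥-elim (proj₁ (All-lookup far i) eq)
  lookup-injective {_ ∷ _ ∷ _} (_ , _ , path)  (fs i)      (fs j)      eq = cong fs (lookup-injective path i j eq)

  adj⇒consecutive : ∀ {L} → IsInducedPath L → ∀ i j → Adj K (lookup L i) (lookup L j) →
                    toℕ j ≡ suc (toℕ i) ⊎ toℕ i ≡ suc (toℕ j)
  adj⇒consecutive {_ ∷ []}    _              fz          fz          e = ⊥-elim (adj⇒≢ e refl)
  adj⇒consecutive {_ ∷ _ ∷ _} _              fz          fz          e = ⊥-elim (adj⇒≢ e refl)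
  adj⇒consecutive {_ ∷ _ ∷ _} _              fz          (fs fz)     e = inj₁ refl
  adj⇒consecutive {_ ∷ _ ∷ _} (_ , far , _)  fz          (fs (fs j)) e = ⊥-elim (proj₂ (All-lookup far j) e)
  adj⇒consecutive {_ ∷ _ ∷ _} _              (fs fz)     fz          e = inj₂ refl
  adj⇒consecutive {_ ∷ _ ∷ _} (_ , far , _)  (fs (fs i)) fz          e = ⊥-elim (proj₂ (All-lookup far i) (adj-sym e))
  adj⇒consecutive {_ ∷ _ ∷ _} (_ , _ , path) (fs i)      (fs j)      e with adj⇒consecutive path i j e
  ... | inj₁ ij = inj₁ (cong suc ij)
  ... | inj₂ ji = inj₂ (cong suc ji)

  consecutive⇒adj : ∀ {L} → IsInducedPath L → ∀ i j → toℕ j ≡ suc (toℕ i) → Adj K (lookup L i) (lookup L j)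
  consecutive⇒adj {_ ∷ _ ∷ _} (pq , _ , _)   fz     (fs fz)     _  = pq
  consecutive⇒adj {_ ∷ _ ∷ _} (_ , _ , path) (fs i) (fs j)      ij = consecutive⇒adj path i j (ℕ.suc-injective ij)
  consecutive⇒adj {_ ∷ _ ∷ _} _              fz     (fs (fs j)) ()
  consecutive⇒adj {_ ∷ []}    _              fz     fz          ()
  consecutive⇒adj {_ ∷ _ ∷ _} _              fz     fz          ()

  EndsAt-index : ∀ {b L} → EndsAt b L → Σ (Fin (length L)) λ j → lookup L j ≡ b × suc (toℕ j) ≡ length L
  EndsAt-index end = fz , refl , refl
  EndsAt-index (more end′) with EndsAt-index end′
  ... | j , jb , last = fs j , jb , cong suc last

  module ClosingCycle {c a b : Fin n} (ca : Adj K c a) (cb : Adj K c b) (a≢b : a ≢ b) (a≁b : ¬ Adj K a b)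
                      {L : List (Fin n)} (path : IsInducedPath (a ∷ L)) (ends : EndsAt b (a ∷ L))
                      (away : All (λ w → Outside K c w ⊎ w ≡ b) L) where

    last : Fin (length (a ∷ L))
    last = proj₁ (EndsAt-index ends)

    last-b : lookup (a ∷ L) last ≡ b
    last-b = proj₁ (proj₂ (EndsAt-index ends))

    last-index : suc (toℕ last) ≡ length (a ∷ L)
    last-index = proj₂ (proj₂ (EndsAt-index ends))

    away-at : ∀ i → Outside K c (lookup L i) ⊎ lookup L i ≡ b
    away-at = All-lookup away

    c-adj⇒end : ∀ i → Adj K c (lookup (a ∷ L) i) → toℕ i ≡ 0 ⊎ suc (toℕ i) ≡ length (a ∷ L)
    c-adj⇒end fz     _ = inj₁ refl
    c-adj⇒end (fs i) e with away-at i
    ... | inj₁ (_ , c≁) = ⊥-elim (c≁ e)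
    ... | inj₂ ib = inj₂ (subst (λ j → suc (toℕ j) ≡ length (a ∷ L))
                                (lookup-injective path last (fs i) (trans last-b (sym ib))) last-index)

    c∉path : ∀ i → c ≢ lookup (a ∷ L) i
    c∉path fz     eq = adj⇒≢ ca eq
    c∉path (fs i) eq with away-at i
    ... | inj₁ (i≢c , _) = i≢c (sym eq)
    ... | inj₂ ib = adj⇒≢ cb (trans eq ib)

    vertex : Fin (2 + length L) → Fin n
    vertex = lookup (c ∷ a ∷ L)

    vertex-injective : ∀ {i j} → vertex i ≡ vertex j → i ≡ j
    vertex-injective {fz}   {fz}   _  = refl
    vertex-injective {fz}   {fs j} eq = ⊥-elim (c∉path j eq)
    vertex-injective {fs i} {fz}   eq = ⊥-elim (c∉path i (sym eq))
    vertex-injective {fs i} {fs j} eq = cong fs (lookup-injective path i j eq)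

    adj⇒cycAdj : ∀ i j → Adj K (vertex i) (vertex j) → CycAdj (2 + length L) i j
    adj⇒cycAdj fz     fz     e = ⊥-elim (adj⇒≢ e refl)
    adj⇒cycAdj fz     (fs j) e with c-adj⇒end j e
    ... | inj₁ j≡0    = inj₁ (inj₁ (cong suc j≡0))
    ... | inj₂ j-last = inj₂ (inj₂ (j-last , refl))
    adj⇒cycAdj (fs i) fz     e = CycAdj-sym (adj⇒cycAdj fz (fs i) (adj-sym e))
    adj⇒cycAdj (fs i) (fs j) e with adj⇒consecutive path i j e
    ... | inj₁ ij = inj₁ (inj₁ (cong suc ij))
    ... | inj₂ ji = inj₂ (inj₁ (cong suc ji))

    next⇒adj : ∀ i j → Next (2 + length L) i j → Adj K (vertex i) (vertex j)
    next⇒adj fz     (fs fz)     (inj₁ _)  = ca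
    next⇒adj (fs i) (fs j)      (inj₁ ij) = consecutive⇒adj path i j (ℕ.suc-injective ij)
    next⇒adj (fs i) fz          (inj₂ (i-last , _)) =
      subst (λ j → Adj K (lookup (a ∷ L) j) c)
            (Fin.toℕ-injective (ℕ.suc-injective (trans last-index (sym i-last))))
            (subst (λ v → Adj K v c) (sym last-b) (adj-sym cb))
    next⇒adj fz     fz          (inj₁ ())
    next⇒adj fz     (fs (fs _)) (inj₁ ())
    next⇒adj (fs _) fz          (inj₁ ())
    next⇒adj fz     fz          (inj₂ (() , _))
    next⇒adj _      (fs _)      (inj₂ (_ , ()))

    closingCycle-long : 4 ≤ 2 + length L
    closingCycle-long = go L path ends
      where
      go : ∀ M → IsInducedPath (a ∷ M) → EndsAt b (a ∷ M) → 4 ≤ 2 + length M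
      go []          _        end              = ⊥-elim (a≢b refl)
      go (w ∷ [])    (ab , _) (more end)       = ⊥-elim (a≁b ab)
      go (_ ∷ _ ∷ _) _        _                = s≤s (s≤s (s≤s (s≤s z≤n)))
      go []          _        (more ())
      go (w ∷ [])    _        (more (more ()))

    closingCycle : InducedCycle K (2 + length L)
    closingCycle = record
      { len≥3   = ℕ.≤-trans (ℕ.n≤1+n 3) closingCycle-long
      ; vtx     = vertex
      ; vtx-inj = vertex-injective
      ; edges   = adj⇒cycAdj
      ; cycle   = λ { i j (inj₁ ij) → next⇒adj i j ij ; i j (inj₂ ji) → adj-sym (next⇒adj j i ji) }
      }

  detour⇒inducedCycle : ∀ {c a b} → Adj K c a → Adj K c b → a ≢ b → ¬ Adj K a b → Detour K c a b →
    ∃₂ λ k (C : InducedCycle K k) → 4 ≤ k × OnCycle C c × OnCycle C a × OnCycle C b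
  detour⇒inducedCycle ca cb a≢b a≁b walk with toInducedPath walk
  ... | L , path , ends , away =
    _ , closingCycle , closingCycle-long , (fz , refl) , (fs fz , refl) , (fs last , last-b)
    where open ClosingCycle ca cb a≢b a≁b path ends away

module CyclicOrder {k : ℕ} where

  Next-functional : ∀ {i j j′} → Next (suc k) i j → Next (suc k) i j′ → j ≡ j′
  Next-functional (inj₁ ij)        (inj₁ ij′)        = Fin.toℕ-injective (trans ij (sym ij′))
  Next-functional (inj₂ (_ , j≡0)) (inj₂ (_ , j′≡0)) = Fin.toℕ-injective (trans j≡0 (sym j′≡0))
  Next-functional {j = j} (inj₁ ij) (inj₂ (i-last , _)) =
    ⊥-elim (ℕ.<-irrefl (trans ij (cong suc i-last)) (Fin.toℕ<n j))
  Next-functional {j′ = j′} (inj₂ (i-last , _)) (inj₁ ij′) =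
    ⊥-elim (ℕ.<-irrefl (trans ij′ (cong suc i-last)) (Fin.toℕ<n j′))

  Next-injective : ∀ {i i′ j} → Next (suc k) i j → Next (suc k) i′ j → i ≡ i′
  Next-injective (inj₁ ij)           (inj₁ i′j)          = Fin.toℕ-injective (ℕ.suc-injective (trans (sym ij) i′j))
  Next-injective (inj₂ (i-last , _)) (inj₂ (i′-last , _)) = Fin.toℕ-injective (trans i-last (sym i′-last))
  Next-injective (inj₁ ij)           (inj₂ (_ , j≡0))    with trans (sym ij) j≡0
  ... | ()
  Next-injective (inj₂ (_ , j≡0))    (inj₁ i′j)          with trans (sym i′j) j≡0
  ... | ()

  Next-surjective : ∀ j → ∃ λ i → Next (suc k) i j
  Next-surjective fz     = fromℕ k , inj₂ (Fin.toℕ-fromℕ k , refl)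
  Next-surjective (fs j) = inject₁ j , inj₁ (cong suc (sym (Fin.toℕ-inject₁ j)))

  next : Fin (suc k) → Fin (suc k)
  next i with toℕ i ℕ.≟ k
  ... | yes _   = fz
  ... | no  i≢k = fs (lower₁ i (λ k≡i → i≢k (sym k≡i)))

  Next-next : ∀ i → Next (suc k) i (next i)
  Next-next i with toℕ i ℕ.≟ k
  ... | yes i≡k = inj₂ (i≡k , refl)
  ... | no  i≢k = inj₁ (cong suc (Fin.toℕ-lower₁ i _))

  Next⇒≡next : ∀ {i j} → Next (suc k) i j → j ≡ next i
  Next⇒≡next {i} ij = Next-functional ij (Next-next i)

  next-injective : ∀ {i i′} → next i ≡ next i′ → i ≡ i′
  next-injective {i} {i′} eq = Next-injective (subst (Next (suc k) i) eq (Next-next i)) (Next-next i′)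

  next-preserves-Next : ∀ {i j} → Next (suc k) i j → Next (suc k) (next i) (next j)
  next-preserves-Next {i} ij =
    subst (λ j → Next (suc k) (next i) (next j)) (sym (Next⇒≡next ij)) (Next-next (next i))

  next-reflects-Next : ∀ {i j} → Next (suc k) (next i) (next j) → Next (suc k) i j
  next-reflects-Next {i} ij = subst (Next (suc k) i) (sym (next-injective (Next⇒≡next ij))) (Next-next i)

module Cycles {n : ℕ} (K : Graph n) where

  rotate : ∀ {k} → InducedCycle K (suc k) → InducedCycle K (suc k)
  rotate {k} C = record
    { len≥3   = len≥3 C
    ; vtx     = λ i → vtx C (next i)
    ; vtx-inj = λ eq → next-injective (vtx-inj C eq)
    ; edges   = λ i j e → Sum.map next-reflects-Next next-reflects-Next (edges C (next i) (next j) e)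
    ; cycle   = λ i j ij → cycle C (next i) (next j) (Sum.map next-preserves-Next next-preserves-Next ij)
    }
    where open CyclicOrder {k}

  RotationTo : ∀ {k} → InducedCycle K (suc k) → Fin (suc k) → Set
  RotationTo {k} C i = Σ (InducedCycle K (suc k)) λ C′ → vtx C′ fz ≡ vtx C i × (∀ j → OnCycle C′ (vtx C j))

  rotateTo : ∀ {k} (C : InducedCycle K (suc k)) (i : Fin (suc k)) → RotationTo C i
  rotateTo {k} C i = go (toℕ i) C i refl
    where
    open CyclicOrder {k}
    go : ∀ r (C : InducedCycle K (suc k)) i → toℕ i ≡ r → RotationTo C i
    go _ C fz _ = C , refl , λ j → j , refl
    go (suc r) C (fs i) i≡r with go r (rotate C) (inject₁ i) (trans (Fin.toℕ-inject₁ i) (ℕ.suc-injective i≡r))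
    ... | C′ , start , onC′ = C′ , trans start (cong (vtx C) (sym (Next⇒≡next inject₁-Next))) , onC
      where
      inject₁-Next : Next (suc k) (inject₁ i) (fs i)
      inject₁-Next = inj₁ (cong suc (sym (Fin.toℕ-inject₁ i)))
      onC : ∀ j → OnCycle C′ (vtx C j)
      onC j with Next-surjective j
      ... | i′ , i′j with onC′ i′
      ...   | j′ , eq = j′ , trans eq (cong (vtx C) (sym (Next⇒≡next i′j)))

  module FromStart {m : ℕ} (C : InducedCycle K (3 + m)) where

    ℓ : Fin (3 + m)
    ℓ = fromℕ< (ℕ.n<1+n (2 + m))

    toℕ-ℓ : toℕ ℓ ≡ 2 + m
    toℕ-ℓ = Fin.toℕ-fromℕ< (ℕ.n<1+n (2 + m))

    start-adj-second : Adj K (vtx C fz) (vtx C (fs fz))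
    start-adj-second = cycle C fz (fs fz) (inj₁ (inj₁ refl))

    start-adj-last : Adj K (vtx C fz) (vtx C ℓ)
    start-adj-last = cycle C fz ℓ (inj₂ (inj₂ (toℕ-ℓ , refl)))

    second≢last : vtx C (fs fz) ≢ vtx C ℓ
    second≢last eq with trans (cong toℕ (vtx-inj C eq)) toℕ-ℓ
    ... | ()

    start-neighbours : ∀ j → Adj K (vtx C fz) (vtx C j) → j ≡ fs fz ⊎ j ≡ ℓ
    start-neighbours j e with edges C fz j e
    ... | inj₁ (inj₁ j≡1)          = inj₁ (Fin.toℕ-injective j≡1)
    ... | inj₂ (inj₂ (j-last , _)) = inj₂ (Fin.toℕ-injective (trans j-last (sym toℕ-ℓ)))
    ... | inj₁ (inj₂ (() , _))
    ... | inj₂ (inj₁ ())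

    AwayFromStart : Fin n → Set
    AwayFromStart w = Outside K (vtx C fz) w ⊎ w ≡ vtx C ℓ

    beyond-second : ∀ j → 2 ≤ toℕ j → AwayFromStart (vtx C j)
    beyond-second j 2≤j with toℕ j ℕ.≟ 2 + m
    ... | yes j-last = inj₂ (cong (vtx C) (Fin.toℕ-injective (trans j-last (sym toℕ-ℓ))))
    ... | no  j≢last = inj₁ (j≢start , j≁start)
      where
      j≢start : vtx C j ≢ vtx C fz
      j≢start eq with subst (λ i → 2 ≤ toℕ i) (vtx-inj C eq) 2≤j
      ... | ()
      j≁start : ¬ Adj K (vtx C fz) (vtx C j)
      j≁start e with start-neighbours j e
      ... | inj₁ j≡1 = ℕ.<-irrefl refl (subst (λ i → 2 ≤ toℕ i) j≡1 2≤j)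
      ... | inj₂ j≡ℓ = j≢last (trans (cong toℕ j≡ℓ) toℕ-ℓ)

    arc : ∀ r (r<k : 1 + r < 3 + m) → Walk K AwayFromStart (vtx C (fs fz)) (vtx C (fromℕ< r<k))
    arc zero    _   = stop
    arc (suc r) r<k = snocWalk (arc r r<k′) (cycle C _ _ (inj₁ (inj₁ consecutive)))
                               (beyond-second j (subst (2 ≤_) (sym (Fin.toℕ-fromℕ< r<k)) (s≤s (s≤s z≤n))))
      where
      r<k′ : 1 + r < 3 + m
      r<k′ = ℕ.<-trans (ℕ.n<1+n _) r<k
      j : Fin (3 + m)
      j = fromℕ< r<k
      consecutive : toℕ j ≡ suc (toℕ (fromℕ< r<k′))
      consecutive = trans (Fin.toℕ-fromℕ< r<k) (cong suc (sym (Fin.toℕ-fromℕ< r<k′)))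

    arcDetour : Detour K (vtx C fz) (vtx C (fs fz)) (vtx C ℓ)
    arcDetour = arc (suc m) (ℕ.n<1+n (2 + m))

  cycle-neighbours : ∀ {k} (C : InducedCycle K k) (i : Fin k) →
    ∃₂ λ p q → p ≢ q × Detour K (vtx C i) p q ×
               (∀ j → Adj K (vtx C i) (vtx C j) → vtx C j ≡ p ⊎ vtx C j ≡ q)
  cycle-neighbours C i with len≥3 C
  cycle-neighbours C i | s≤s (s≤s (s≤s _)) with rotateTo C i
  ... | C′ , start , onC′ =
    vtx C′ (fs fz) , vtx C′ ℓ , second≢last , subst (λ c → Detour K c _ _) start arcDetour , neighbour
    where
    open FromStart C′
    neighbour : ∀ j → Adj K (vtx C i) (vtx C j) → vtx C j ≡ vtx C′ (fs fz) ⊎ vtx C j ≡ vtx C′ ℓ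
    neighbour j e with onC′ j
    ... | j′ , j′≡j with start-neighbours j′ (subst₂ (Adj K) (sym start) (sym j′≡j) e)
    ...   | inj₁ refl = inj₁ (sym j′≡j)
    ...   | inj₂ refl = inj₂ (sym j′≡j)

module Chordality {n : ℕ} (K : Graph n) where

  open AdjProperties K
  open InducedPaths K
  open Cycles K

  chordal⇒shortcut : Chordal K → ShortcutProperty K
  chordal⇒shortcut chordal c a b ca cb a≢b detour with adj? a b
  ... | yes ab  = ab
  ... | no  a≁b with detour⇒inducedCycle ca cb a≢b a≁b detour
  ...   | k , C , long , _ = ⊥-elim (chordal k long C)

  shortcut⇒chordal : ShortcutProperty K → Chordal K
  shortcut⇒chordal shortcut _ (s≤s (s≤s (s≤s (s≤s _)))) C =
    second≁last (shortcut _ _ _ start-adj-second start-adj-last second≢last arcDetour)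
    where
    open FromStart C
    second≁last : ¬ Adj K (vtx C (fs fz)) (vtx C ℓ)
    second≁last e with edges C (fs fz) ℓ e
    ... | inj₁ (inj₁ ℓ≡2) with trans (sym toℕ-ℓ) ℓ≡2
    ...   | ()
    second≁last e | inj₂ (inj₁ 1≡1+ℓ) with trans (sym toℕ-ℓ) (sym (ℕ.suc-injective 1≡1+ℓ))
    ...   | ()
    second≁last e | inj₁ (inj₂ (() , _))
    second≁last e | inj₂ (inj₂ (_ , ()))

module _ {n : ℕ} {G H : Graph n} {u : Fin n} (G⊆H : G ⊆E H) (noFill : NoFillAt G H u) where

  private
    module G = AdjProperties G
    module H = AdjProperties H

  detour-lift : ∀ {a b} → Detour G u a b → Detour H u a b
  detour-lift = mapWalk (G⊆H _ _) λ { (inj₁ (w≢u , u≁w)) → inj₁ (w≢u , λ uw → u≁w (noFill _ uw))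
                                    ; (inj₂ w≡b)         → inj₂ w≡b }

  avoidable⇒simplicial : ShortcutProperty H → Avoidable G u → Simplicial H u
  avoidable⇒simplicial shortcut avoidable x y ux uy x≢y with H.adj? x y
  ... | yes xy = xy
  ... | no x≁y with avoidable x y (G.adj-sym (noFill x ux)) (noFill y uy) x≢y (λ xy → x≁y (G⊆H x y xy))
  ...   | _ , C , (ix , refl) , (iu , refl) , (iy , refl) with Cycles.cycle-neighbours G C iu
  ...     | _ , _ , _ , detour , neighbour with neighbour ix (noFill _ ux) | neighbour iy (noFill _ uy)
  ...       | inj₁ refl | inj₂ refl = shortcut _ _ _ ux uy x≢y (detour-lift detour)
  ...       | inj₂ refl | inj₁ refl =
    H.adj-sym (shortcut _ _ _ uy ux (λ yx → x≢y (sym yx)) (detour-lift detour))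
  ...       | inj₁ xp   | inj₁ yp   = ⊥-elim (x≢y (trans xp (sym yp)))
  ...       | inj₂ xq   | inj₂ yq   = ⊥-elim (x≢y (trans xq (sym yq)))

record Component {n : ℕ} (G : Graph n) (u x : Fin n) : Set where
  field
    members : Subset n
    source  : x ∈ members
    reached : ∀ {v} → v ∈ members → v ≡ x ⊎ (Outside G u v × Walk G (Outside G u) x v)
    closed  : ∀ {a v} → a ∈ members → Outside G u v → Adj G a v → v ∈ members

module _ {n : ℕ} (G : Graph n) (u x : Fin n) where

  open AdjProperties G

  private
    Sound : Subset n → Set
    Sound p = x ∈ p × (∀ {v} → v ∈ p → v ≡ x ⊎ (Outside G u v × Walk G (Outside G u) x v))

    Grown : Subset n → Fin n → Set
    Grown p v = v ∈ p ⊎ (Outside G u v × ∃ λ a → a ∈ p × Adj G a v)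

    grown? : ∀ p v → Dec (Grown p v)
    grown? p v = (v ∈? p) ⊎-dec ((¬? (v Fin.≟ u) ×-dec ¬? (adj? u v))
                                 ×-dec Fin.any? (λ a → (a ∈? p) ×-dec adj? a v))

    grow : Subset n → Subset n
    grow p = Vec.tabulate (λ v → isYes (grown? p v))

    ∈-grow⁻ : ∀ {p v} → v ∈ grow p → Grown p v
    ∈-grow⁻ {p} {v} v∈ = toWitness {a? = grown? p v}
      (Equivalence.from Bool.T-≡ (trans (sym (Vec.lookup∘tabulate _ v)) (Vec.[]=⇒lookup v∈)))

    ∈-grow⁺ : ∀ {p v} → Grown p v → v ∈ grow p
    ∈-grow⁺ {p} {v} g = Vec.lookup⇒[]= v (grow p)
      (trans (Vec.lookup∘tabulate _ v) (Equivalence.to Bool.T-≡ (fromWitness g)))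

    grow-sound : ∀ {p} → Sound p → Sound (grow p)
    grow-sound {p} (x∈p , sound) = ∈-grow⁺ (inj₁ x∈p) , sound′
      where
      sound′ : ∀ {v} → v ∈ grow p → v ≡ x ⊎ (Outside G u v × Walk G (Outside G u) x v)
      sound′ v∈ with ∈-grow⁻ v∈
      ... | inj₁ v∈p = sound v∈p
      ... | inj₂ (out , a , a∈p , av) with sound a∈p
      ...   | inj₁ refl       = inj₂ (out , step av out stop)
      ...   | inj₂ (_ , walk) = inj₂ (out , snocWalk walk av out)

    -- Each proper growth step enlarges the subset, so n steps of fuel suffice.
    saturate : ∀ fuel p → n < ∣ p ∣ + fuel → Sound p → Component G u x
    saturate fuel p bound sound with p ⊂? grow p
    saturate zero p bound sound | yes _ =
      ⊥-elim (ℕ.<⇒≱ (subst (n <_) (ℕ.+-identityʳ _) bound) (∣p∣≤n p))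
    saturate (suc fuel) p bound sound | yes p⊂grow =
      saturate fuel (grow p) bound′ (grow-sound sound)
      where
      bound′ : n < ∣ grow p ∣ + fuel
      bound′ = ℕ.≤-<-trans (s≤s⁻¹ (subst (n <_) (ℕ.+-suc ∣ p ∣ fuel) bound))
                           (ℕ.+-monoˡ-< fuel (p⊂q⇒∣p∣<∣q∣ p⊂grow))
    ... | no ¬p⊂grow = record { members = p ; source = proj₁ sound ; reached = proj₂ sound ; closed = closed }
      where
      closed : ∀ {a v} → a ∈ p → Outside G u v → Adj G a v → v ∈ p
      closed {a} {v} a∈p out av with v ∈? p
      ... | yes v∈p = v∈p
      ... | no  v∉p =
        ⊥-elim (¬p⊂grow ((λ w∈p → ∈-grow⁺ (inj₁ w∈p)) , v , ∈-grow⁺ (inj₂ (out , a , a∈p , av)) , v∉p))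

  component : Component G u x
  component = saturate n ⁅ x ⁆ (subst (λ s → n < s + n) (sym (∣⁅x⁆∣≡1 x)) (ℕ.n<1+n n))
                       (x∈⁅x⁆ x , λ v∈ → inj₁ (x∈⁅y⁆⇒x≡y x v∈))

module CutAlong {n : ℕ} {G H : Graph n} {u : Fin n} (G⊆H : G ⊆E H) (simplicial : Simplicial H u)
                (A : Subset n) (closed : ∀ {a v} → a ∈ A → Outside G u v → Adj G a v → v ∈ A) where

  private
    module G = AdjProperties G
    module H = AdjProperties H

  Boundary : Fin n → Set
  Boundary v = v ∉ A × ∃ λ a → a ∈ A × Adj G a v

  Beyond : Fin n → Set
  Beyond v = v ∉ A × ¬ Boundary v

  boundary? : ∀ v → Dec (Boundary v)
  boundary? v = ¬? (v ∈? A) ×-dec Fin.any? (λ a → (a ∈? A) ×-dec G.adj? a v)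

  Separated : Fin n → Fin n → Set
  Separated p q = (p ∈ A × Beyond q) ⊎ (Beyond p × q ∈ A)

  separated? : ∀ p q → Dec (Separated p q)
  separated? p q = ((p ∈? A) ×-dec beyond? q) ⊎-dec (beyond? p ×-dec (q ∈? A))
    where beyond? = λ v → ¬? (v ∈? A) ×-dec ¬? (boundary? v)

  Separated-sym : ∀ {p q} → Separated p q → Separated q p
  Separated-sym (inj₁ (p∈A , q-beyond)) = inj₂ (q-beyond , p∈A)
  Separated-sym (inj₂ (p-beyond , q∈A)) = inj₁ (q∈A , p-beyond)

  H′ : Graph n
  H′ = record
    { adj    = λ p q → not (does (separated? p q)) ∧ adj H p q
    ; sym    = λ p q → cong₂ _∧_
                 (cong not (does-⇔ (mk⇔ Separated-sym Separated-sym) (separated? p q) (separated? q p)))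
                 (Graph.sym H p q)
    ; irrefl = λ p → trans (cong (not (does (separated? p p)) ∧_) (Graph.irrefl H p)) (Bool.∧-zeroʳ _)
    }

  H′-adj⇒ : ∀ {p q} → Adj H′ p q → Adj H p q × ¬ Separated p q
  H′-adj⇒ {p} {q} = from (separated? p q)
    where
    from : (d : Dec (Separated p q)) → not (does d) ∧ adj H p q ≡ true → Adj H p q × ¬ Separated p q
    from (yes _)  ()
    from (no ¬pq) pq = pq , ¬pq

  H′-adj⇐ : ∀ {p q} → Adj H p q → ¬ Separated p q → Adj H′ p q
  H′-adj⇐ {p} {q} pq ¬sep = to (separated? p q)
    where
    to : (d : Dec (Separated p q)) → not (does d) ∧ adj H p q ≡ true
    to (yes sep) = ⊥-elim (¬sep sep)
    to (no _)    = pq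

  H′⊆H : H′ ⊆E H
  H′⊆H p q pq = proj₁ (H′-adj⇒ pq)

  G⊆H′ : G ⊆E H′
  G⊆H′ p q pq = H′-adj⇐ (G⊆H p q pq) unseparated
    where
    unseparated : ¬ Separated p q
    unseparated (inj₁ (p∈A , q∉A , q-inner)) = q-inner (q∉A , p , p∈A , pq)
    unseparated (inj₂ ((p∉A , p-inner) , q∈A)) = p-inner (p∉A , q , q∈A , G.adj-sym pq)

  boundary⊆N[u] : ∀ {v} → Boundary v → v ≡ u ⊎ Adj G u v
  boundary⊆N[u] {v} (v∉A , a , a∈A , av) with v Fin.≟ u | G.adj? u v
  ... | yes v≡u | _       = inj₁ v≡u
  ... | no _    | yes uv  = inj₂ uv
  ... | no v≢u  | no u≁v  = ⊥-elim (v∉A (closed a∈A (v≢u , u≁v) av))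

  boundary-clique : ∀ {s t} → Boundary s → Boundary t → s ≢ t → Adj H′ s t
  boundary-clique {s} {t} bs bt s≢t = H′-adj⇐ st unseparated
    where
    st : Adj H s t
    st with boundary⊆N[u] bs | boundary⊆N[u] bt
    ... | inj₁ s≡u | inj₁ t≡u = ⊥-elim (s≢t (trans s≡u (sym t≡u)))
    ... | inj₁ refl | inj₂ ut = G⊆H _ _ ut
    ... | inj₂ us | inj₁ refl = H.adj-sym (G⊆H _ _ us)
    ... | inj₂ us | inj₂ ut = simplicial s t (G⊆H _ _ us) (G⊆H _ _ ut) s≢t
    unseparated : ¬ Separated s t
    unseparated (inj₁ (s∈A , _))      = proj₁ bs s∈A
    unseparated (inj₂ ((_ , ¬bs) , _)) = ¬bs bs

  data Region (v : Fin n) : Set where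
    inside   : v ∈ A → Region v
    boundary : Boundary v → Region v
    beyond   : Beyond v → Region v

  region : ∀ v → Region v
  region v with v ∈? A | boundary? v
  ... | yes v∈A | _       = inside v∈A
  ... | no  _   | yes bv  = boundary bv
  ... | no  v∉A | no ¬bv  = beyond (v∉A , ¬bv)

  module Confine (X Y : Fin n → Set) (split : ∀ v → X v ⊎ Y v) (disjoint : ∀ {v} → X v → ¬ Y v)
                 (exit  : ∀ {p q} → Adj H′ p q → X p → Y q → Boundary p)
                 (entry : ∀ {p q} → Adj H′ p q → Y p → X q → Boundary q)
                 (boundary⊆X : ∀ {v} → Boundary v → X v)
                 (unseparated : ∀ {p q} → X p → X q → ¬ Separated p q) where

    -- An excursion into Y leaves and re-enters X through the boundary, which is a clique.
    mutual
      confine : ∀ {Q p q} → Walk H′ Q p q → X p → X q → Walk H′ (λ w → Q w × X w) p q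
      confine stop _ _ = stop
      confine (step {w = w} pw qw rest) xp xq with split w
      ... | inj₁ xw = step pw (qw , xw) (confine rest xw xq)
      ... | inj₂ yw = reenter (exit pw xp yw) yw rest xq

      reenter : ∀ {Q p w q} → Boundary p → Y w → Walk H′ Q w q → X q → Walk H′ (λ w → Q w × X w) p q
      reenter _ yq stop xq = ⊥-elim (disjoint xq yq)
      reenter {p = p} bp yw (step {w = w′} ww′ qw′ rest) xq with split w′
      ... | inj₂ yw′ = reenter bp yw′ rest xq
      ... | inj₁ xw′ with p Fin.≟ w′
      ...   | yes refl = confine rest (boundary⊆X bp) xq
      ...   | no p≢w′  =
        step (boundary-clique bp (entry ww′ yw xw′) p≢w′) (qw′ , xw′) (confine rest xw′ xq)

    shortcut-within : ShortcutProperty H → ∀ {c a b} → X c → X a → X b →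
      Adj H′ c a → Adj H′ c b → a ≢ b → Detour H′ c a b → Adj H′ a b
    shortcut-within shortcut {c} {a} {b} xc xa xb ca cb a≢b detour =
      H′-adj⇐ (shortcut c a b (proj₁ (H′-adj⇒ ca)) (proj₁ (H′-adj⇒ cb)) a≢b
                        (mapWalk (λ e → proj₁ (H′-adj⇒ e)) lift (confine detour xa xb)))
              (unseparated xa xb)
      where
      lift : ∀ {w} → (Outside H′ c w ⊎ w ≡ b) × X w → Outside H c w ⊎ w ≡ b
      lift (inj₁ (w≢c , c≁w) , xw) = inj₁ (w≢c , λ cw → c≁w (H′-adj⇐ cw (unseparated xc xw)))
      lift (inj₂ w≡b , _)          = inj₂ w≡b

  not-beyond : ∀ {v} → v ∈ A ⊎ Boundary v → ¬ Beyond v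
  not-beyond (inj₁ v∈A) (v∉A , _)   = v∉A v∈A
  not-beyond (inj₂ bv)  (_ , ¬bv)   = ¬bv bv

  not-inside : ∀ {v} → Boundary v ⊎ Beyond v → v ∉ A
  not-inside (inj₁ (v∉A , _)) = v∉A
  not-inside (inj₂ (v∉A , _)) = v∉A

  module NearSide where
    private
      split : ∀ v → (v ∈ A ⊎ Boundary v) ⊎ Beyond v
      split v with region v
      ... | inside v∈A  = inj₁ (inj₁ v∈A)
      ... | boundary bv = inj₁ (inj₂ bv)
      ... | beyond bv   = inj₂ bv
      exit : ∀ {p q} → Adj H′ p q → p ∈ A ⊎ Boundary p → Beyond q → Boundary p
      exit pq (inj₁ p∈A) bq = ⊥-elim (proj₂ (H′-adj⇒ pq) (inj₁ (p∈A , bq)))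
      exit pq (inj₂ bp)  _  = bp
      entry : ∀ {p q} → Adj H′ p q → Beyond p → q ∈ A ⊎ Boundary q → Boundary q
      entry pq bp (inj₁ q∈A) = ⊥-elim (proj₂ (H′-adj⇒ pq) (inj₂ (bp , q∈A)))
      entry pq _  (inj₂ bq)  = bq
      unseparated : ∀ {p q} → p ∈ A ⊎ Boundary p → q ∈ A ⊎ Boundary q → ¬ Separated p q
      unseparated _  xq (inj₁ (_ , bq)) = not-beyond xq bq
      unseparated xp _  (inj₂ (bp , _)) = not-beyond xp bp
    open Confine (λ v → v ∈ A ⊎ Boundary v) Beyond split not-beyond exit entry inj₂ unseparated public

  module FarSide where
    private
      split : ∀ v → (Boundary v ⊎ Beyond v) ⊎ v ∈ A
      split v with region v
      ... | inside v∈A  = inj₂ v∈A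
      ... | boundary bv = inj₁ (inj₁ bv)
      ... | beyond bv   = inj₁ (inj₂ bv)
      exit : ∀ {p q} → Adj H′ p q → Boundary p ⊎ Beyond p → q ∈ A → Boundary p
      exit pq (inj₁ bp) _   = bp
      exit pq (inj₂ bp) q∈A = ⊥-elim (proj₂ (H′-adj⇒ pq) (inj₂ (bp , q∈A)))
      entry : ∀ {p q} → Adj H′ p q → p ∈ A → Boundary q ⊎ Beyond q → Boundary q
      entry pq _   (inj₁ bq) = bq
      entry pq p∈A (inj₂ bq) = ⊥-elim (proj₂ (H′-adj⇒ pq) (inj₁ (p∈A , bq)))
      unseparated : ∀ {p q} → Boundary p ⊎ Beyond p → Boundary q ⊎ Beyond q → ¬ Separated p q
      unseparated xp _  (inj₁ (p∈A , _)) = not-inside xp p∈A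
      unseparated _  xq (inj₂ (_ , q∈A)) = not-inside xq q∈A
    open Confine (λ v → Boundary v ⊎ Beyond v) (_∈ A) split not-inside exit entry inj₁ unseparated public

  neighbour-of-inside : ∀ {c v} → c ∈ A → Adj H′ c v → v ∈ A ⊎ Boundary v
  neighbour-of-inside {v = v} c∈A cv with region v
  ... | inside v∈A  = inj₁ v∈A
  ... | boundary bv = inj₂ bv
  ... | beyond bv   = ⊥-elim (proj₂ (H′-adj⇒ cv) (inj₁ (c∈A , bv)))

  neighbour-of-beyond : ∀ {c v} → Beyond c → Adj H′ c v → Boundary v ⊎ Beyond v
  neighbour-of-beyond {v = v} bc cv with region v
  ... | inside v∈A  = ⊥-elim (proj₂ (H′-adj⇒ cv) (inj₂ (bc , v∈A)))
  ... | boundary bv = inj₁ bv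
  ... | beyond bv   = inj₂ bv

  crossing-from-inside : ∀ {Q p q} → Walk H′ Q p q → p ∈ A → Beyond q → ∃ λ s → Boundary s × Q s
  crossing-from-inside stop p∈A (q∉A , _) = ⊥-elim (q∉A p∈A)
  crossing-from-inside (step {w = w} pw qw rest) p∈A bq with region w
  ... | inside w∈A  = crossing-from-inside rest w∈A bq
  ... | boundary bw = w , bw , qw
  ... | beyond bw   = ⊥-elim (proj₂ (H′-adj⇒ pw) (inj₁ (p∈A , bw)))

  crossing-from-beyond : ∀ {Q p q} → Walk H′ Q p q → Beyond p → q ∈ A → ∃ λ s → Boundary s × Q s
  crossing-from-beyond stop (p∉A , _) q∈A = ⊥-elim (p∉A q∈A)
  crossing-from-beyond (step {w = w} pw qw rest) bp q∈A with region w
  ... | inside w∈A  = ⊥-elim (proj₂ (H′-adj⇒ pw) (inj₂ (bp , w∈A)))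
  ... | boundary bw = w , bw , qw
  ... | beyond bw   = crossing-from-beyond rest bw q∈A

  detour-misses-boundary : ∀ {c b s} → Boundary c → ¬ Boundary b → Boundary s → ¬ (Outside H′ c s ⊎ s ≡ b)
  detour-misses-boundary bc _   bs (inj₁ (s≢c , c≁s)) = c≁s (boundary-clique bc bs (λ c≡s → s≢c (sym c≡s)))
  detour-misses-boundary _  ¬bb bs (inj₂ refl)        = ¬bb bs

  shortcut-at-boundary : ShortcutProperty H → ∀ {c a b} → Boundary c → Region a → Region b →
    Adj H′ c a → Adj H′ c b → a ≢ b → Detour H′ c a b → Adj H′ a b
  shortcut-at-boundary shortcut bc (inside a∈A) (inside b∈A) =
    NearSide.shortcut-within shortcut (inj₂ bc) (inj₁ a∈A) (inj₁ b∈A)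
  shortcut-at-boundary shortcut bc (inside a∈A) (boundary bb) =
    NearSide.shortcut-within shortcut (inj₂ bc) (inj₁ a∈A) (inj₂ bb)
  shortcut-at-boundary shortcut bc (boundary ba) (inside b∈A) =
    NearSide.shortcut-within shortcut (inj₂ bc) (inj₂ ba) (inj₁ b∈A)
  shortcut-at-boundary shortcut bc (boundary ba) (boundary bb) =
    NearSide.shortcut-within shortcut (inj₂ bc) (inj₂ ba) (inj₂ bb)
  shortcut-at-boundary shortcut bc (boundary ba) (beyond bb) =
    FarSide.shortcut-within shortcut (inj₁ bc) (inj₁ ba) (inj₂ bb)
  shortcut-at-boundary shortcut bc (beyond ba) (boundary bb) =
    FarSide.shortcut-within shortcut (inj₁ bc) (inj₂ ba) (inj₁ bb)
  shortcut-at-boundary shortcut bc (beyond ba) (beyond bb) =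
    FarSide.shortcut-within shortcut (inj₁ bc) (inj₂ ba) (inj₂ bb)
  shortcut-at-boundary shortcut bc (inside a∈A) (beyond bb) _ _ _ detour
    with crossing-from-inside detour a∈A bb
  ... | s , bs , away = ⊥-elim (detour-misses-boundary bc (proj₂ bb) bs away)
  shortcut-at-boundary shortcut bc (beyond ba) (inside b∈A) _ _ _ detour
    with crossing-from-beyond detour ba b∈A
  ... | s , bs , away = ⊥-elim (detour-misses-boundary bc (λ bb → proj₁ bb b∈A) bs away)

  cut-shortcut : ShortcutProperty H → ShortcutProperty H′
  cut-shortcut shortcut c a b ca cb with region c
  ... | inside c∈A  = NearSide.shortcut-within shortcut (inj₁ c∈A)
                        (neighbour-of-inside c∈A ca) (neighbour-of-inside c∈A cb) ca cb
  ... | boundary bc = shortcut-at-boundary shortcut bc (region a) (region b) ca cb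
  ... | beyond bc   = FarSide.shortcut-within shortcut (inj₂ bc)
                        (neighbour-of-beyond bc ca) (neighbour-of-beyond bc cb) ca cb

simplicial⇒avoidable : ∀ {n} {G H : Graph n} {u : Fin n} →
  MinimalTriangulation G H → Simplicial H u → Avoidable G u
simplicial⇒avoidable {G = G} {H} {u} (G⊆H , chordal , minimal) simplicial x y xu uy x≢y x≁y =
  case Fin.any? (λ a → (a ∈? members) ×-dec G.adj? a y) of λ
    { (yes (a , a∈A , ay)) → cycle-through a∈A ay
    ; (no y-far) → ⊥-elim (minimal H′ G⊆H′ H′⊆H (x , y , xy , x≁′y y-far) H′-chordal)
    }
  where
  module G = AdjProperties G
  module H = AdjProperties H
  open Component (component G u x)
  open CutAlong {G = G} {H} {u} G⊆H simplicial members closed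

  cycle-through : ∀ {a} → a ∈ members → Adj G a y → PathInInducedCycle G x u y
  cycle-through a∈A ay with reached a∈A
  ... | inj₁ refl = ⊥-elim (x≁y ay)
  ... | inj₂ (_ , walk) with InducedPaths.detour⇒inducedCycle G (G.adj-sym xu) uy x≢y x≁y
                               (snocWalk (mapWalk id inj₁ walk) ay (inj₂ refl))
  ...   | k , C , _ , onU , onX , onY = k , C , onX , onU , onY

  H′-chordal : Chordal H′
  H′-chordal = Chordality.shortcut⇒chordal H′ (cut-shortcut (Chordality.chordal⇒shortcut H chordal))

  xy : Adj H x y
  xy = simplicial x y (H.adj-sym (G⊆H x u xu)) (G⊆H u y uy) x≢y

  x≁′y : ¬ (∃ λ a → a ∈ members × Adj G a y) → ¬ Adj H′ x y
  x≁′y y-far xy′ =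
    proj₂ (H′-adj⇒ xy′) (inj₁ (source , y∉A , λ (_ , a , a∈A , ay) → y-far (a , a∈A , ay)))
    where
    y∉A : y ∉ members
    y∉A y∈A with reached y∈A
    ... | inj₁ y≡x             = x≢y (sym y≡x)
    ... | inj₂ ((_ , u≁y) , _) = u≁y uy

lemma13 : ∀ {n : ℕ} (G H : Graph n) (u : Fin n) →
    MinimalTriangulation G H → NoFillAt G H u →
    (Avoidable G u → Simplicial H u) × (Simplicial H u → Avoidable G u)
lemma13 G H u minimal@(G⊆H , chordal , _) noFill =
  avoidable⇒simplicial G⊆H noFill (Chordality.chordal⇒shortcut H chordal) , simplicial⇒avoidable minimal
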